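{- For positive integers $a, b$ define $$P_{ab}(x,y,z) = a^2y^2z+abxyz+aby^3+b^2xy^2+ax^2z+axy^2-2ayz^2+2bx^2y-bxz^2-by^2z+x^3-3xyz+y^3+z^3,$$ and let $F_{ab}(x,y,z) = (y, z, az + by + x)$ (one step of the recurrence $u(n) = a\,u(n-1) + b\,u(n-2) + u(n-3)$). For every positive integer $b$ there exists $A(b)$ such that for every integer $a \ge A(b)$ the following holds: there is a finite set $\mathcal{F}$ of integer solutions of $P_{ab} = 1$ such that every integer solution $(x,y,z)$ of $P_{ab}(x,y,z) = 1$ with $0 < x < y < z$ is of the form $F_{ab}^n(s)$ for some $s \in \mathcal{F}$ and some integer $n \ge 0$.
   Context: $F_{ab}^n$ denotes the $n$-fold composition of $F_{ab}$. -}

module Defs where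

open import Data.Nat using (ℕ; zero; suc)
open import Data.Integer using (ℤ; +_; _+_; _*_; _-_; _<_)
open import Data.Product using (_×_; _,_)

Triple : Set
Triple = ℤ × ℤ × ℤ

P : ℤ → ℤ → Triple → ℤ
P a b (x , y , z) =
  a * a * y * y * z + a * b * x * y * z + a * b * y * y * y + b * b * x * y * y
  + a * x * x * z + a * x * y * y - + 2 * a * y * z * z + + 2 * b * x * x * y
  - b * x * z * z - b * y * y * z + x * x * x - + 3 * x * y * z + y * y * y + z * z * z

F : ℤ → ℤ → Triple → Triple
F a b (x , y , z) = (y , z , a * z + b * y + x)

Fⁿ : ℤ → ℤ → ℕ → Triple → Triple
Fⁿ a b zero    s = s
Fⁿ a b (suc n) s = F a b (Fⁿ a b n s)

{-# OPTIONS --safe #-}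
module Submission where

-- P is invariant under F, so F⁻¹ (x , y , z) = (z - a y - b x , x , y) maps solutions to
-- solutions.  For a ≥ b² + 4b + 12 the predecessor (u , x , y) of an ascending solution
-- (x , y , z) is again ascending (0 < u < x), unless it is (0 , 1 , a) = F (0 , 0 , 1):
-- in every other region P (u , x , y) ≠ 1, witnessed by writing k P - k - 1 (k > 0) as a sum
-- of products of quantities that are nonnegative there.  As z decreases strictly, descent from
-- any ascending solution ends at (0 , 1 , a), so 𝓕 = {(0 , 0 , 1)} works.

open import Data.Nat as ℕ using (ℕ; suc; z≤n)
open import Data.Nat.Induction using (<-wellFounded)
open import Data.Integer
  using (ℤ; +_; -[1+_]; _+_; _*_; _-_; -_; ∣_∣; _≤_; _<_; +≤+; +<+; _≤?_; _<?_)
open import Data.Integer.Properties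
  using ( ≤-trans; ≤-antisym; ≤-<-trans; <-trans; <⇒≤; ≮⇒≥; ≰⇒>; i<j⇒suc[i]≤j
        ; i≤j⇒0≤j-i; neg-mono-≤; +-mono-≤; *-monoʳ-≤-nonNeg; *-identityʳ; 0≤i⇒+∣i∣≡i)
open import Data.Integer.Solver using (module +-*-Solver)
open import Data.List using (_∷_; [])
open import Data.List.Relation.Unary.All using (All; _∷_; [])
open import Data.List.Relation.Unary.Any using (here)
open import Data.List.Membership.Propositional using (_∈_)
open import Data.Product using (∃-syntax; _×_; _,_; proj₁; proj₂)
open import Data.Sum using (_⊎_; inj₁; inj₂)
open import Data.Empty using (⊥-elim)
open import Induction.WellFounded using (Acc; acc)
open import Relation.Nullary using (yes; no; contradiction)
open import Relation.Binary.PropositionalEquality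
  using (_≡_; _≢_; refl; sym; trans; cong; cong₂; subst; module ≡-Reasoning)
open +-*-Solver using (Polynomial; con; _:+_; _:*_; _:-_; :-_; _:=_; solve)

open import Defs

infix 9 #_

#_ : ∀ {n} → ℕ → Polynomial n
# k = con (+ k)

infixl 6 _⊕_
infixl 7 _⊛_

_⊕_ : ∀ {i j} → + 0 ≤ i → + 0 ≤ j → + 0 ≤ i + j
_⊕_ = +-mono-≤

_⊛_ : ∀ {i j} → + 0 ≤ i → + 0 ≤ j → + 0 ≤ i * j
0≤i ⊛ +≤+ _ = *-monoʳ-≤-nonNeg _ 0≤i

0≤+ : ∀ n → + 0 ≤ + n
0≤+ _ = +≤+ z≤n

0≤i*i : ∀ i → + 0 ≤ i * i
0≤i*i (+ n)    = 0≤+ n ⊛ 0≤+ n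
0≤i*i -[1+ n ] = +≤+ z≤n

i<j⇒0≤j-i-1 : ∀ {i j} → i < j → + 0 ≤ j - i - + 1
i<j⇒0≤j-i-1 {i} {j} i<j = subst (+ 0 ≤_)
  (solve 2 (λ i j → j :- (# 1 :+ i) := j :- i :- # 1) refl i j)
  (i≤j⇒0≤j-i (i<j⇒suc[i]≤j i<j))

0≤i<j⇒∣i∣<∣j∣ : ∀ {i j} → + 0 ≤ i → i < j → ∣ i ∣ ℕ.< ∣ j ∣
0≤i<j⇒∣i∣<∣j∣ (+≤+ _) (+<+ m<n) = m<n

k*p≡k+1+e⇒p≢1 : ∀ k {p e} → + 0 ≤ e → k * p ≡ k + + 1 + e → p ≢ + 1
k*p≡k+1+e⇒p≢1 k {e = e} 0≤e k*p≡k+1+e refl = contradiction (subst (+ 0 ≤_) e≡-1 0≤e) λ ()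
  where
  open ≡-Reasoning
  e≡-1 : e ≡ - + 1
  e≡-1 = begin
    e                        ≡⟨ solve 2 (λ k e → e := k :+ # 1 :+ e :- k :- # 1) refl k e ⟩
    k + + 1 + e - k - + 1    ≡⟨ cong (λ w → w - k - + 1) k*p≡k+1+e ⟨
    k * + 1 - k - + 1        ≡⟨ solve 1 (λ k → k :* # 1 :- k :- # 1 := # 0 :- # 1) refl k ⟩
    - + 1                    ∎

i*i*i≡1⇒i≡1 : ∀ {i} → + 1 ≤ i → i * i * i ≡ + 1 → i ≡ + 1
i*i*i≡1⇒i≡1 {i} 1≤i i³≡1 with i ≤? + 1
... | yes i≤1 = ≤-antisym i≤1 1≤i
... | no  i≰1 = contradiction i³≡1 (k*p≡k+1+e⇒p≢1 (+ 1)
      (0≤i-2 ⊛ (0≤i ⊛ 0≤i ⊕ 0≤+ 2 ⊛ 0≤i ⊕ 0≤+ 4) ⊕ 0≤+ 6)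
      (solve 1 (λ i → # 1 :* (i :* i :* i) := # 1 :+ # 1 :+
                        ((i :- # 2) :* (i :* i :+ # 2 :* i :+ # 4) :+ # 6)) refl i))
  where
  2≤i : + 2 ≤ i
  2≤i = i<j⇒suc[i]≤j (≰⇒> i≰1)
  0≤i-2 : + 0 ≤ i - + 2
  0≤i-2 = i≤j⇒0≤j-i 2≤i
  0≤i : + 0 ≤ i
  0≤i = ≤-trans (0≤+ 2) 2≤i

A : ℤ → ℤ
A b = b * b + + 4 * b + + 12

Ascending : Triple → Set
Ascending (x , y , z) = + 0 < x × x < y × y < z

F⁻¹ : ℤ → ℤ → Triple → Triple
F⁻¹ a b (x , y , z) = z - a * y - b * x , x , y

seed : Triple
seed = + 0 , + 0 , + 1

-- P in the ring solver's syntax: its semantics unfolds definitionally to P, so solver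
-- identities about Pᵖ are identities about P.
Pᵖ : ∀ {n} → Polynomial n → Polynomial n → Polynomial n → Polynomial n → Polynomial n →
     Polynomial n
Pᵖ a b x y z =
  a :* a :* y :* y :* z :+ a :* b :* x :* y :* z :+ a :* b :* y :* y :* y :+ b :* b :* x :* y :* y
  :+ a :* x :* x :* z :+ a :* x :* y :* y :- # 2 :* a :* y :* z :* z :+ # 2 :* b :* x :* x :* y
  :- b :* x :* z :* z :- b :* y :* y :* z :+ x :* x :* x :- # 3 :* x :* y :* z :+ y :* y :* y
  :+ z :* z :* z

Aᵖ : ∀ {n} → Polynomial n → Polynomial n
Aᵖ b = b :* b :+ # 4 :* b :+ # 12

P∘F : ∀ a b s → P a b (F a b s) ≡ P a b s
P∘F a b (u , x , y) =
  solve 5 (λ a b u x y → Pᵖ a b x y (a :* y :+ b :* x :+ u) := Pᵖ a b u x y) refl a b u x y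

F∘F⁻¹ : ∀ a b t → F a b (F⁻¹ a b t) ≡ t
F∘F⁻¹ a b (x , y , z) = cong (λ w → x , y , w)
  (solve 5 (λ a b x y z → a :* y :+ b :* x :+ (z :- a :* y :- b :* x) := z) refl a b x y z)

P∘F⁻¹ : ∀ a b t → P a b (F⁻¹ a b t) ≡ P a b t
P∘F⁻¹ a b t = trans (sym (P∘F a b (F⁻¹ a b t))) (cong (P a b) (F∘F⁻¹ a b t))

P-seed : ∀ a b → P a b seed ≡ + 1
P-seed a b = solve 2 (λ a b → Pᵖ a b (# 0) (# 0) (# 1) := # 1) refl a b

F-seed : ∀ a b → F a b seed ≡ (+ 0 , + 1 , a)
F-seed a b = cong (λ w → + 0 , + 1 , w) (solve 2 (λ a b → a :* # 1 :+ b :* # 0 :+ # 0 := a) refl a b)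

P[0,x,ax]≡x³ : ∀ a b x → P a b (+ 0 , x , a * x) ≡ x * x * x
P[0,x,ax]≡x³ a b x = solve 3 (λ a b x → Pᵖ a b (# 0) x (a :* x) := x :* x :* x) refl a b x

0≤A : ∀ {b} → + 0 ≤ b → + 0 ≤ A b
0≤A 0≤b = 0≤b ⊛ 0≤b ⊕ 0≤+ 4 ⊛ 0≤b ⊕ 0≤+ 12

y<ax⇒P[0,x,y]≢1 : ∀ {a b x y} → + 0 ≤ b → + 0 ≤ x → + 2 ≤ y → y < a * x →
                  P a b (+ 0 , x , y) ≢ + 1
y<ax⇒P[0,x,y]≢1 {a} {b} {x} {y} 0≤b 0≤x 2≤y y<ax = k*p≡k+1+e⇒p≢1 (+ 1)
  (0≤y-2 ⊛ 0≤g ⊛ 0≤g ⊕ 0≤+ 2 ⊛ 0≤g-1 ⊛ (0≤g ⊕ 0≤+ 1) ⊕ 0≤b ⊛ 0≤g ⊛ 0≤x ⊛ 0≤x ⊕ 0≤x ⊛ 0≤x ⊛ 0≤x)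
  (solve 4 (λ a b x y → let g = a :* x :- y in
     # 1 :* Pᵖ a b (# 0) x y := # 1 :+ # 1 :+
       ((y :- # 2) :* g :* g :+ # 2 :* (g :- # 1) :* (g :+ # 1) :+ b :* g :* x :* x :+ x :* x :* x))
     refl a b x y)
  where
  0≤y-2 : + 0 ≤ y - + 2
  0≤y-2 = i≤j⇒0≤j-i 2≤y
  0≤g : + 0 ≤ a * x - y
  0≤g = i≤j⇒0≤j-i (<⇒≤ y<ax)
  0≤g-1 : + 0 ≤ a * x - y - + 1
  0≤g-1 = i<j⇒0≤j-i-1 y<ax

P[0,x,y]≡1∧y≤ax⇒x≡1∧y≡a : ∀ {a b x y} → + 0 ≤ b → + 1 ≤ x → + 2 ≤ y → y ≤ a * x →
                           P a b (+ 0 , x , y) ≡ + 1 → x ≡ + 1 × y ≡ a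
P[0,x,y]≡1∧y≤ax⇒x≡1∧y≡a {a} {b} {x} {y} 0≤b 1≤x 2≤y y≤ax P≡1 with y <? a * x
... | yes y<ax = ⊥-elim (y<ax⇒P[0,x,y]≢1 {a} {b} 0≤b (≤-trans (0≤+ 1) 1≤x) 2≤y y<ax P≡1)
... | no  y≮ax = x≡1 , trans y≡ax (trans (cong (a *_) x≡1) (*-identityʳ a))
  where
  y≡ax : y ≡ a * x
  y≡ax = ≤-antisym y≤ax (≮⇒≥ y≮ax)
  x≡1 : x ≡ + 1
  x≡1 = i*i*i≡1⇒i≡1 1≤x
    (trans (sym (P[0,x,ax]≡x³ a b x)) (subst (λ w → P a b (+ 0 , x , w) ≡ + 1) y≡ax P≡1))

module Predecessor {a b u x y : ℤ} (0≤b : + 0 ≤ b) (A≤a : A b ≤ a)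
                   (ascending : Ascending (F a b (u , x , y))) where

  private
    z : ℤ
    z = a * y + b * x + u

    -- 4a - b², written so that its nonnegativity is visible
    d : ℤ
    d = + 4 * (a - A b) + + 3 * b * b + + 16 * b + + 48

    dᵖ : ∀ {n} → Polynomial n → Polynomial n → Polynomial n
    dᵖ a b = # 4 :* (a :- Aᵖ b) :+ # 3 :* b :* b :+ # 16 :* b :+ # 48

    0<x : + 0 < x
    0<x = proj₁ ascending
    x<y : x < y
    x<y = proj₁ (proj₂ ascending)
    y<z : y < z
    y<z = proj₂ (proj₂ ascending)

    0≤a-A : + 0 ≤ a - A b
    0≤a-A = i≤j⇒0≤j-i A≤a
    0≤a : + 0 ≤ a
    0≤a = ≤-trans (0≤A 0≤b) A≤a
    0≤d : + 0 ≤ d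
    0≤d = 0≤+ 4 ⊛ 0≤a-A ⊕ 0≤+ 3 ⊛ 0≤b ⊛ 0≤b ⊕ 0≤+ 16 ⊛ 0≤b ⊕ 0≤+ 48
    1≤x : + 1 ≤ x
    1≤x = i<j⇒suc[i]≤j 0<x
    0≤x : + 0 ≤ x
    0≤x = <⇒≤ 0<x
    0≤x-1 : + 0 ≤ x - + 1
    0≤x-1 = i≤j⇒0≤j-i 1≤x
    2≤y : + 2 ≤ y
    2≤y = i<j⇒suc[i]≤j (≤-<-trans 1≤x x<y)
    0≤y : + 0 ≤ y
    0≤y = ≤-trans (0≤+ 2) 2≤y
    3≤z : + 3 ≤ z
    3≤z = i<j⇒suc[i]≤j (≤-<-trans 2≤y y<z)
    0≤z : + 0 ≤ z
    0≤z = ≤-trans (0≤+ 3) 3≤z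
    0≤z-3 : + 0 ≤ z - + 3
    0≤z-3 = i≤j⇒0≤j-i 3≤z

  x≤u⇒P≢1 : x ≤ u → P a b (u , x , y) ≢ + 1
  x≤u⇒P≢1 x≤u = k*p≡k+1+e⇒p≢1 (+ 4)
    (0≤y ⊛ 0≤i*i (+ 2 * y - + 2 * a * x - b * u)
    ⊕ 0≤y ⊛ ((0≤+ 4 ⊛ 0≤a-A ⊕ 0≤+ 3 ⊛ 0≤b ⊛ 0≤b ⊕ 0≤+ 12 ⊛ 0≤b ⊕ 0≤+ 36) ⊛ 0≤u ⊛ 0≤u
             ⊕ 0≤+ 12 ⊛ 0≤u ⊛ 0≤u-x ⊕ 0≤+ 4 ⊛ 0≤b ⊛ 0≤u-x ⊛ (0≤u ⊕ 0≤x))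
    ⊕ 0≤+ 4 ⊛ (0≤a ⊛ 0≤b ⊛ 0≤x ⊛ 0≤x ⊛ 0≤x ⊕ 0≤x-1 ⊛ (0≤x ⊛ 0≤x ⊕ 0≤x ⊕ 0≤+ 1)
              ⊕ (0≤a ⊕ 0≤b ⊛ 0≤b) ⊛ 0≤u ⊛ 0≤x ⊛ 0≤x ⊕ 0≤+ 2 ⊛ 0≤b ⊛ 0≤u ⊛ 0≤u ⊛ 0≤x
              ⊕ 0≤u-1 ⊛ (0≤u ⊛ 0≤u ⊕ 0≤u ⊕ 0≤+ 1))
    ⊕ 0≤+ 3)
    (solve 5 (λ a b u x y → let w = # 2 :* y :- # 2 :* a :* x :- b :* u in
       # 4 :* Pᵖ a b u x y := # 4 :+ # 1 :+
         (y :* (w :* w)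
         :+ y :* ((# 4 :* (a :- Aᵖ b) :+ # 3 :* b :* b :+ # 12 :* b :+ # 36) :* u :* u
                 :+ # 12 :* u :* (u :- x) :+ # 4 :* b :* (u :- x) :* (u :+ x))
         :+ # 4 :* (a :* b :* x :* x :* x :+ (x :- # 1) :* (x :* x :+ x :+ # 1)
                   :+ (a :+ b :* b) :* u :* x :* x :+ # 2 :* b :* u :* u :* x
                   :+ (u :- # 1) :* (u :* u :+ u :+ # 1))
         :+ # 3))
       refl a b u x y)
    where
    0≤u-x : + 0 ≤ u - x
    0≤u-x = i≤j⇒0≤j-i x≤u
    0≤u : + 0 ≤ u
    0≤u = ≤-trans 0≤x x≤u
    0≤u-1 : + 0 ≤ u - + 1
    0≤u-1 = i≤j⇒0≤j-i (≤-trans 1≤x x≤u)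

  -- With h = y - a x, the square x (2x - b h)² is the AM-GM step a x h² + x³ ≥ b x² h.
  u≤0∧ax<y⇒P≢1 : u ≤ + 0 → a * x < y → P a b (u , x , y) ≢ + 1
  u≤0∧ax<y⇒P≢1 u≤0 ax<y = k*p≡k+1+e⇒p≢1 (+ 4)
    (0≤+ 4 ⊛ (0≤-u ⊛ 0≤-u ⊛ (0≤z ⊕ 0≤b ⊛ 0≤x)
              ⊕ 0≤-u ⊛ 0≤x ⊛ 0≤x ⊛ (0≤+ 2 ⊛ 0≤a-A ⊕ 0≤b ⊛ 0≤b ⊕ 0≤+ 8 ⊛ 0≤b ⊕ 0≤+ 24)
              ⊕ 0≤-u ⊛ 0≤h ⊛ (0≤+ 3 ⊛ 0≤x ⊕ 0≤b ⊛ 0≤y)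
              ⊕ 0≤h ⊛ 0≤h ⊛ 0≤h)
    ⊕ 0≤x ⊛ 0≤i*i (+ 2 * x - b * (y - a * x))
    ⊕ 0≤d ⊛ (0≤x-1 ⊛ 0≤h ⊛ 0≤h ⊕ 0≤h-1 ⊛ (0≤h ⊕ 0≤+ 1))
    ⊕ (0≤+ 4 ⊛ 0≤a-A ⊕ 0≤+ 3 ⊛ 0≤b ⊛ 0≤b ⊕ 0≤+ 16 ⊛ 0≤b ⊕ 0≤+ 43))
    (solve 5 (λ a b u x y → let z = a :* y :+ b :* x :+ u; h = y :- a :* x; v = :- u in
       # 4 :* Pᵖ a b u x y := # 4 :+ # 1 :+
         (# 4 :* (v :* v :* (z :+ b :* x)
                 :+ v :* x :* x :* (# 2 :* (a :- Aᵖ b) :+ b :* b :+ # 8 :* b :+ # 24)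
                 :+ v :* h :* (# 3 :* x :+ b :* y)
                 :+ h :* h :* h)
         :+ x :* ((# 2 :* x :- b :* h) :* (# 2 :* x :- b :* h))
         :+ dᵖ a b :* ((x :- # 1) :* h :* h :+ (h :- # 1) :* (h :+ # 1))
         :+ (# 4 :* (a :- Aᵖ b) :+ # 3 :* b :* b :+ # 16 :* b :+ # 43)))
       refl a b u x y)
    where
    0≤-u : + 0 ≤ - u
    0≤-u = neg-mono-≤ u≤0
    0≤h : + 0 ≤ y - a * x
    0≤h = i≤j⇒0≤j-i (<⇒≤ ax<y)
    0≤h-1 : + 0 ≤ y - a * x - + 1
    0≤h-1 = i<j⇒0≤j-i-1 ax<y

  u<0∧y≤ax⇒P≢1 : u < + 0 → y ≤ a * x → P a b (u , x , y) ≢ + 1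
  u<0∧y≤ax⇒P≢1 u<0 y≤ax = k*p≡k+1+e⇒p≢1 (+ 4 * a)
    (0≤i*i (+ 2 * y - + 2 * a * x - b * u) ⊛ 0≤z
    ⊕ 0≤d ⊛ (0≤z-3 ⊛ 0≤i*i u ⊕ 0≤+ 3 ⊛ 0≤-u-1 ⊛ (0≤-u ⊕ 0≤+ 1))
    ⊕ (0≤+ 8 ⊛ 0≤a-A ⊕ 0≤+ 5 ⊛ 0≤b ⊛ 0≤b ⊕ 0≤+ 32 ⊛ 0≤b ⊕ 0≤+ 95)
    ⊕ 0≤+ 4 ⊛ (0≤a ⊛ 0≤x ⊛ 0≤x ⊛ 0≤x
              ⊕ (0≤a-A ⊕ 0≤+ 4 ⊛ 0≤b ⊕ 0≤+ 12) ⊛ 0≤x ⊛ 0≤y ⊛ 0≤-u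
              ⊕ 0≤b ⊛ 0≤x ⊛ 0≤y ⊛ 0≤g
              ⊕ 0≤b ⊛ 0≤y ⊛ 0≤-u ⊛ 0≤-u
              ⊕ 0≤y ⊛ 0≤y ⊛ 0≤-u))
    (solve 5 (λ a b u x y → let w = # 2 :* y :- # 2 :* a :* x :- b :* u
                                z = a :* y :+ b :* x :+ u
                                v = :- u in
       # 4 :* a :* Pᵖ a b u x y := # 4 :* a :+ # 1 :+
         (w :* w :* z
         :+ dᵖ a b :* ((z :- # 3) :* (u :* u) :+ # 3 :* (# 0 :- u :- # 1) :* (v :+ # 1))
         :+ (# 8 :* (a :- Aᵖ b) :+ # 5 :* b :* b :+ # 32 :* b :+ # 95)
         :+ # 4 :* (a :* x :* x :* x
                   :+ (a :- Aᵖ b :+ # 4 :* b :+ # 12) :* x :* y :* v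
                   :+ b :* x :* y :* (a :* x :- y)
                   :+ b :* y :* v :* v
                   :+ y :* y :* v)))
       refl a b u x y)
    where
    0≤-u : + 0 ≤ - u
    0≤-u = neg-mono-≤ (<⇒≤ u<0)
    0≤-u-1 : + 0 ≤ + 0 - u - + 1
    0≤-u-1 = i<j⇒0≤j-i-1 u<0
    0≤g : + 0 ≤ a * x - y
    0≤g = i≤j⇒0≤j-i y≤ax

  ascending-or-[0,1,a] : P a b (u , x , y) ≡ + 1 →
                         Ascending (u , x , y) ⊎ (u , x , y) ≡ (+ 0 , + 1 , a)
  ascending-or-[0,1,a] P≡1 with u ≤? + 0 | u <? x
  ... | no u≰0  | yes u<x = inj₁ (≰⇒> u≰0 , u<x , x<y)
  ... | no _    | no u≮x  = ⊥-elim (x≤u⇒P≢1 (≮⇒≥ u≮x) P≡1)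
  ... | yes u≤0 | _ with a * x <? y | u <? + 0
  ...   | yes ax<y | _       = ⊥-elim (u≤0∧ax<y⇒P≢1 u≤0 ax<y P≡1)
  ...   | no ax≮y  | yes u<0 = ⊥-elim (u<0∧y≤ax⇒P≢1 u<0 (≮⇒≥ ax≮y) P≡1)
  ...   | no ax≮y  | no u≮0  =
    let u≡0 = ≤-antisym u≤0 (≮⇒≥ u≮0)
        (x≡1 , y≡a) = P[0,x,y]≡1∧y≤ax⇒x≡1∧y≡a {a} {b} 0≤b 1≤x 2≤y (≮⇒≥ ax≮y)
                        (subst (λ w → P a b (w , x , y) ≡ + 1) u≡0 P≡1)
    in inj₂ (cong₂ _,_ u≡0 (cong₂ _,_ x≡1 y≡a))

module _ {a b : ℤ} (0≤b : + 0 ≤ b) (A≤a : A b ≤ a) where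

  descend : ∀ {x y z} → Acc ℕ._<_ ∣ z ∣ → Ascending (x , y , z) → P a b (x , y , z) ≡ + 1 →
            ∃[ n ] Fⁿ a b n seed ≡ (x , y , z)
  descend {x} {y} {z} (acc rs) ascending@(0<x , x<y , y<z) P≡1 =
    let (n , Fⁿseed≡s) = s∈orbit (Predecessor.ascending-or-[0,1,a] 0≤b A≤a ascending′ Ps≡1)
    in suc n , trans (cong (F a b) Fⁿseed≡s) (F∘F⁻¹ a b (x , y , z))
    where
    s : Triple
    s = F⁻¹ a b (x , y , z)
    ascending′ : Ascending (F a b s)
    ascending′ = subst Ascending (sym (F∘F⁻¹ a b (x , y , z))) ascending
    Ps≡1 : P a b s ≡ + 1
    Ps≡1 = trans (P∘F⁻¹ a b (x , y , z)) P≡1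
    ∣y∣<∣z∣ : ∣ y ∣ ℕ.< ∣ z ∣
    ∣y∣<∣z∣ = 0≤i<j⇒∣i∣<∣j∣ (<⇒≤ (<-trans 0<x x<y)) y<z
    s∈orbit : Ascending s ⊎ s ≡ (+ 0 , + 1 , a) → ∃[ n ] Fⁿ a b n seed ≡ s
    s∈orbit (inj₁ ascending-s) = descend (rs ∣y∣<∣z∣) ascending-s Ps≡1
    s∈orbit (inj₂ s≡[0,1,a])   = 1 , trans (F-seed a b) (sym s≡[0,1,a])

  ascending-solution∈orbit : ∀ {t} → Ascending t → P a b t ≡ + 1 → ∃[ n ] Fⁿ a b n seed ≡ t
  ascending-solution∈orbit {_ , _ , z} = descend (<-wellFounded ∣ z ∣)

proposition4p3 : (b : ℕ) → 1 ℕ.≤ b →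
    ∃[ A ] ((a : ℕ) → 1 ℕ.≤ a → A ℕ.≤ a →
    ∃[ 𝓕 ] (All (λ s → P (+ a) (+ b) s ≡ + 1) 𝓕 ×
    ((x y z : ℤ) → P (+ a) (+ b) (x , y , z) ≡ + 1 →
    + 0 < x → x < y → y < z →
    ∃[ s ] ∃[ n ] (s ∈ 𝓕 × Fⁿ (+ a) (+ b) n s ≡ (x , y , z)))))
proposition4p3 b _ = ∣ A (+ b) ∣ , λ a _ A≤a →
  seed ∷ [] , P-seed (+ a) (+ b) ∷ [] , λ x y z P≡1 0<x x<y y<z →
    let A≤+a = subst (_≤ + a) (0≤i⇒+∣i∣≡i (0≤A (0≤+ b))) (+≤+ A≤a)
        (n , Fⁿseed≡t) = ascending-solution∈orbit (0≤+ b) A≤+a (0<x , x<y , y<z) P≡1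
    in seed , n , here refl , Fⁿseed≡t
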